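{- Let $G$ be a connected graph of order $n\geq 2$. Then $\mathcal{L}(G)\leq F_{xt}(G)\leq \left\lfloor \frac{n}{fix(G)}\right\rfloor$. Both bounds are sharp.
   Context: All graphs are finite, simple; throughout the paper graphs are assumed connected and symmetric (nontrivial automorphism group, so $fix(G)\geq 1$). A fixing set of $G$ is a set $F\subseteq V(G)$ such that the only automorphism fixing every vertex of $F$ is the identity; $fix(G)$ is the minimum size of a fixing set. A fixatic partition is a partition of $V(G)$ into classes each of which is a fixing set; $F_{xt}(G)$ is the maximum number of classes in one. For an ordered set $W=\{w_1,\dots,w_k\}\subseteq V(G)$, the code of $v$ is $(d(v,w_1),\dots,d(v,w_k))$ ($d$ = graph distance); $W$ is a locating set if distinct vertices have distinct codes. A locatic partition is a partition of $V(G)$ into classes each of which is a locating set; the locatic number $\mathcal{L}(G)$ is the maximum number of classes in a locatic partition. -}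

module Defs where

open import Data.Nat using (ℕ; zero; suc; _≤_)
open import Data.Fin using (Fin)
open import Data.Fin.Subset using (Subset; _∈_; ∣_∣)
open import Data.Fin.Permutation using (Permutation′; _⟨$⟩ʳ_)
open import Data.Bool using (Bool; true; false)
open import Data.Product using (Σ; ∃; _×_; _,_)
open import Function.Definitions using (Surjective)
open import Relation.Binary.PropositionalEquality using (_≡_)
open import Relation.Nullary using (¬_)

record Graph (n : ℕ) : Set where
  field
    adj    : Fin n → Fin n → Bool
    sym    : ∀ u v → adj u v ≡ adj v u
    irrefl : ∀ v → adj v v ≡ false
open Graph public

data Walk {n : ℕ} (G : Graph n) : Fin n → Fin n → ℕ → Set where
  here : ∀ {u} → Walk G u u zero
  step : ∀ {u w v k} → adj G u w ≡ true → Walk G w v k → Walk G u v (suc k)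

Connected : ∀ {n} → Graph n → Set
Connected {n} G = ∀ (u v : Fin n) → ∃ λ k → Walk G u v k

IsDist : ∀ {n} → Graph n → Fin n → Fin n → ℕ → Set
IsDist G u v k = Walk G u v k × (∀ j → Walk G u v j → k ≤ j)

IsAut : ∀ {n} → Graph n → Permutation′ n → Set
IsAut G σ = ∀ u v → adj G (σ ⟨$⟩ʳ u) (σ ⟨$⟩ʳ v) ≡ adj G u v

IsIdentity : ∀ {n} → Permutation′ n → Set
IsIdentity σ = ∀ v → σ ⟨$⟩ʳ v ≡ v

Symmetric : ∀ {n} → Graph n → Set
Symmetric {n} G = Σ (Permutation′ n) λ σ → IsAut G σ × ¬ IsIdentity σ

IsFixingSet : ∀ {n} → Graph n → (Fin n → Set) → Set
IsFixingSet {n} G F = ∀ (σ : Permutation′ n) → IsAut G σ →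
  (∀ v → F v → σ ⟨$⟩ʳ v ≡ v) → IsIdentity σ

IsFix : ∀ {n} → Graph n → ℕ → Set
IsFix {n} G k =
  (Σ (Subset n) λ S → IsFixingSet G (_∈ S) × ∣ S ∣ ≡ k) ×
  (∀ (S : Subset n) → IsFixingSet G (_∈ S) → k ≤ ∣ S ∣)

IsLocatingSet : ∀ {n} → Graph n → (Fin n → Set) → Set
IsLocatingSet {n} G W = ∀ (u v : Fin n) →
  (∀ w → W w → ∃ λ k → IsDist G u w k × IsDist G v w k) → u ≡ v

-- A partition of V(G) into m (nonempty) classes, given by a surjective
-- class map c : Fin n → Fin m; class i is { v | c v ≡ i }.
Class : ∀ {n m} → (Fin n → Fin m) → Fin m → Fin n → Set
Class c i v = c v ≡ i

IsPartition : ∀ {n m} → (Fin n → Fin m) → Set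
IsPartition c = Surjective _≡_ _≡_ c

FixaticPartition : ∀ {n} → Graph n → ℕ → Set
FixaticPartition {n} G m = Σ (Fin n → Fin m) λ c →
  IsPartition c × (∀ i → IsFixingSet G (Class c i))

LocaticPartition : ∀ {n} → Graph n → ℕ → Set
LocaticPartition {n} G m = Σ (Fin n → Fin m) λ c →
  IsPartition c × (∀ i → IsLocatingSet G (Class c i))

IsFxt : ∀ {n} → Graph n → ℕ → Set
IsFxt G m = FixaticPartition G m × (∀ m′ → FixaticPartition G m′ → m′ ≤ m)

IsLocatic : ∀ {n} → Graph n → ℕ → Set
IsLocatic G m = LocaticPartition G m × (∀ m′ → LocaticPartition G m′ → m′ ≤ m)

module Submission where

-- Upper bounds.  (1) In a connected graph every locating set is a fixing
-- set: an automorphism σ fixing W pointwise preserves distances, so v and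
-- σ v have the same code with respect to W, hence σ v = v.  Therefore
-- every locatic partition is a fixatic partition, and 𝓛(G) ≤ F_xt(G).
-- (2) The class sizes of a partition of V(G) into m classes sum to n; if
-- every class is a fixing set, each has at least fix(G) elements, so
-- m · fix(G) ≤ n, i.e. m ≤ ⌊n / fix(G)⌋.
--
-- Both bounds are attained by K₂: its two singletons are
-- locating (hence fixing) sets, so 𝓛(K₂) = F_xt(K₂) = 2 = 2 / fix(K₂),
-- where fix(K₂) = 1 because a symmetric graph has no empty fixing set.

open import Defs
open import Data.Nat using (ℕ; zero; suc; _≤_; _<_; _/_; NonZero; _+_; _*_; z≤n; s≤s)
open import Data.Nat.Properties
  using (≤-refl; ≮⇒≥; m≤n⇒m<n∨m≡n; n≤0⇒n≡0; +-mono-≤; +-0-commutativeMonoid)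
open import Data.Nat.DivMod using (m*n/n≡m; /-monoˡ-≤)
open import Data.Fin using (Fin; zero; suc; _≟_)
open import Data.Fin.Properties using (any?)
open import Data.Fin.Subset using (Subset; _∈_; ∣_∣; ⁅_⁆; _⊆_)
open import Data.Fin.Subset.Properties using (x∈⁅y⁆⇒x≡y; ∣⁅x⁆∣≡1; p⊆q⇒∣p∣≤∣q∣; nonempty?; x∈⁅x⁆)
open import Data.Fin.Permutation
  using (Permutation′; _⟨$⟩ʳ_; _⟨$⟩ˡ_; inverseʳ; inverseˡ; flip; transpose)
open import Data.Vec using (_∷_; []; here; there)
open import Data.Bool using (Bool; true; false)
import Data.Bool as Bool
open import Data.Product using (Σ; ∃; _×_; _,_; proj₂)
open import Data.Sum using (_⊎_; inj₁; inj₂)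
open import Data.Empty using (⊥-elim)
open import Relation.Nullary using (¬_; Dec; yes; no; does; _×-dec_)
open import Relation.Binary.PropositionalEquality
  using (_≡_; _≢_; refl; trans; cong; cong₂; subst; subst₂; module ≡-Reasoning)
  renaming (sym to ≡-sym)
open import Algebra.Properties.CommutativeMonoid.Sum +-0-commutativeMonoid
  using (sum; ∑-distrib-+; sum-cong-≗; sum-replicate-zero)

-- Least number principle: a decidable predicate on ℕ that holds somewhere
-- has a least witness.  It turns "some walk exists" into "a distance exists".
module _ (P : ℕ → Set) (P? : ∀ k → Dec (P k)) where

  private
    scan : ∀ b → (∃ λ j → P j × (∀ i → P i → j ≤ i)) ⊎ (∀ i → i < b → ¬ P i)
    scan zero = inj₂ λ i ()
    scan (suc b) with scan b
    ... | inj₁ least = inj₁ least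
    ... | inj₂ none-below-b with P? b
    ...   | yes Pb = inj₁ (b , Pb , λ i Pi → ≮⇒≥ λ i<b → none-below-b i i<b Pi)
    ...   | no ¬Pb = inj₂ none-below-suc-b
      where
      none-below-suc-b : ∀ i → i < suc b → ¬ P i
      none-below-suc-b i (s≤s i≤b) with m≤n⇒m<n∨m≡n i≤b
      ... | inj₁ i<b  = none-below-b i i<b
      ... | inj₂ refl = ¬Pb

  least-witness : ∀ {k} → P k → ∃ λ j → P j × (∀ i → P i → j ≤ i)
  least-witness {k} Pk with scan (suc k)
  ... | inj₁ least = least
  ... | inj₂ none  = ⊥-elim (none k ≤-refl Pk)

module _ {n : ℕ} (G : Graph n) where

  map-walk : (f : Fin n → Fin n) →
             (∀ {a b} → adj G a b ≡ true → adj G (f a) (f b) ≡ true) →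
             ∀ {u v k} → Walk G u v k → Walk G (f u) (f v) k
  map-walk f f-edge here        = here
  map-walk f f-edge (step uw p) = step (f-edge uw) (map-walk f f-edge p)

  walk? : ∀ k u v → Dec (Walk G u v k)
  walk? zero u v with u ≟ v
  ... | yes refl = yes here
  ... | no u≢v   = no λ { here → u≢v refl }
  walk? (suc k) u v with any? (λ w → (adj G u w Bool.≟ true) ×-dec walk? k w v)
  ... | yes (w , uw , p) = yes (step uw p)
  ... | no ¬next         = no λ { (step {w = w} uw p) → ¬next (w , uw , p) }

  distance : Connected G → ∀ u v → ∃ (IsDist G u v)
  distance connected u v =
    least-witness (λ k → Walk G u v k) (λ k → walk? k u v) (proj₂ (connected u v))

  -- Only w itself is at distance 0 from w, and d(w, w) = 0: so if u and
  -- v are equidistant from w and u = w, then v = w.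
  equidistant-from-self : ∀ {u v w k} → IsDist G u w k → IsDist G v w k → u ≡ w → v ≡ w
  equidistant-from-self (_ , minimal) _ refl
    with n≤0⇒n≡0 (minimal 0 here)
  equidistant-from-self _ (here , _) refl | refl = refl

  aut-edge : ∀ σ → IsAut G σ → ∀ {a b} → adj G a b ≡ true →
             adj G (σ ⟨$⟩ʳ a) (σ ⟨$⟩ʳ b) ≡ true
  aut-edge σ aut {a} {b} ab = trans (aut a b) ab

  aut-inverse : ∀ σ → IsAut G σ → IsAut G (flip σ)
  aut-inverse σ aut a b =
    trans (≡-sym (aut (σ ⟨$⟩ˡ a) (σ ⟨$⟩ˡ b))) (cong₂ (adj G) (inverseʳ σ) (inverseʳ σ))

  -- Automorphisms preserve distances: walks are mapped forward by σ, and
  -- shorter walks between the images would be mapped back by σ⁻¹.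
  aut-dist : ∀ σ {u w k} → IsAut G σ → IsDist G u w k →
             IsDist G (σ ⟨$⟩ʳ u) (σ ⟨$⟩ʳ w) k
  aut-dist σ aut (walk , minimal) =
    map-walk (σ ⟨$⟩ʳ_) (aut-edge σ aut) walk ,
    λ j image-walk → minimal j
      (subst₂ (λ x y → Walk G x y j) (inverseˡ σ) (inverseˡ σ)
        (map-walk (σ ⟨$⟩ˡ_) (aut-edge (flip σ) (aut-inverse σ aut)) image-walk))

  -- In a connected graph every locating set W is a fixing set: if σ fixes
  -- W pointwise, then d(σ v, w) = d(σ v, σ w) = d(v, w) for w ∈ W, so v
  -- and σ v share their code and hence coincide.
  locating⇒fixing : Connected G → ∀ W → IsLocatingSet G W → IsFixingSet G W
  locating⇒fixing connected W locating σ aut σ-fixes-W v =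
    locating (σ ⟨$⟩ʳ v) v same-code
    where
    same-code : ∀ w → W w → ∃ λ k → IsDist G (σ ⟨$⟩ʳ v) w k × IsDist G v w k
    same-code w w∈W with distance connected v w
    ... | k , d = k , subst (λ x → IsDist G (σ ⟨$⟩ʳ v) x k) (σ-fixes-W w w∈W) (aut-dist σ aut d) , d

  locatic⇒fixatic : Connected G → ∀ {m} → LocaticPartition G m → FixaticPartition G m
  locatic⇒fixatic connected (c , partition , locating) =
    c , partition , λ i → locating⇒fixing connected (Class c i) (locating i)

classSet : ∀ {n m} → (Fin n → Fin m) → Fin m → Subset n
classSet {zero}  c i = []
classSet {suc n} c i = does (c zero ≟ i) ∷ classSet (λ v → c (suc v)) i

∈-classSet : ∀ {n m} (c : Fin n → Fin m) i v → c v ≡ i → v ∈ classSet c i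
∈-classSet c i zero cv≡i with c zero ≟ i
... | yes _    = here
... | no cv≢i  = ⊥-elim (cv≢i cv≡i)
∈-classSet c i (suc v) cv≡i = there (∈-classSet (λ v → c (suc v)) i v cv≡i)

indicator : Bool → ℕ
indicator true  = 1
indicator false = 0

∣∷∣ : ∀ {n} b (p : Subset n) → ∣ b ∷ p ∣ ≡ indicator b + ∣ p ∣
∣∷∣ true  p = refl
∣∷∣ false p = refl

∑-δ : ∀ {m} (j : Fin m) → sum (λ i → indicator (does (j ≟ i))) ≡ 1
∑-δ {suc m} zero    = cong suc (sum-replicate-zero m)
∑-δ {suc m} (suc j) = ∑-δ j

∑-classSet : ∀ {n m} (c : Fin n → Fin m) → sum (λ i → ∣ classSet c i ∣) ≡ n
∑-classSet {zero}  {m} c = sum-replicate-zero m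
∑-classSet {suc n}     c = begin
  sum (λ i → ∣ classSet c i ∣)
    ≡⟨ sum-cong-≗ (λ i → ∣∷∣ (does (c zero ≟ i)) (classSet c′ i)) ⟩
  sum (λ i → indicator (does (c zero ≟ i)) + ∣ classSet c′ i ∣)
    ≡⟨ ∑-distrib-+ (λ i → indicator (does (c zero ≟ i))) (λ i → ∣ classSet c′ i ∣) ⟩
  sum (λ i → indicator (does (c zero ≟ i))) + sum (λ i → ∣ classSet c′ i ∣)
    ≡⟨ cong₂ _+_ (∑-δ (c zero)) (∑-classSet c′) ⟩
  suc n ∎
  where
  open ≡-Reasoning
  c′ : Fin n → Fin _
  c′ v = c (suc v)

∑-lower-bound : ∀ {m} k (g : Fin m → ℕ) → (∀ i → k ≤ g i) → m * k ≤ sum g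
∑-lower-bound {zero}  k g k≤g = z≤n
∑-lower-bound {suc m} k g k≤g =
  +-mono-≤ (k≤g zero) (∑-lower-bound k (λ i → g (suc i)) (λ i → k≤g (suc i)))

-- A fixatic partition into m classes satisfies m · fix(G) ≤ n, since every
-- class is a fixing set and so has at least fix(G) elements.
fixatic-count : ∀ {n m f} (G : Graph n) → FixaticPartition G m → IsFix G f → m * f ≤ n
fixatic-count {n} {m} {f} G (c , _ , fixing) (_ , fix-minimal) =
  subst (m * f ≤_) (∑-classSet c)
    (∑-lower-bound f (λ i → ∣ classSet c i ∣) λ i → fix-minimal (classSet c i) (class-fixing i))
  where
  class-fixing : ∀ i → IsFixingSet G (_∈ classSet c i)
  class-fixing i σ aut σ-fixes = fixing i σ aut λ v cv≡i → σ-fixes v (∈-classSet c i v cv≡i)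

fixatic-bound : ∀ {n m f} (G : Graph n) → FixaticPartition G m → IsFix G f →
                (nz : NonZero f) → m ≤ _/_ n f {{nz}}
fixatic-bound {n} {m} {f} G partition fix nz =
  subst (_≤ _/_ n f {{nz}}) (m*n/n≡m m f {{nz}})
    (/-monoˡ-≤ f {{nz}} (fixatic-count G partition fix))

-- In a symmetric graph the empty set is not fixing, so fix(G) ≥ 1.
symmetric⇒fixing-nonempty : ∀ {n} (G : Graph n) → Symmetric G →
                            ∀ S → IsFixingSet G (_∈ S) → 1 ≤ ∣ S ∣
symmetric⇒fixing-nonempty G (σ , aut , nontrivial) S fixing with nonempty? S
... | yes (x , x∈S) = subst (_≤ ∣ S ∣) (∣⁅x⁆∣≡1 x) (p⊆q⇒∣p∣≤∣q∣ ⁅x⁆⊆S)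
  where
  ⁅x⁆⊆S : ⁅ x ⁆ ⊆ S
  ⁅x⁆⊆S y∈⁅x⁆ = subst (_∈ S) (≡-sym (x∈⁅y⁆⇒x≡y x y∈⁅x⁆)) x∈S
... | no empty = ⊥-elim (nontrivial (fixing σ aut λ v v∈S → ⊥-elim (empty (v , v∈S))))

fin2-other : ∀ {x a b : Fin 2} → a ≢ x → b ≢ x → a ≡ b
fin2-other {zero}     {suc zero} {suc zero} _   _   = refl
fin2-other {suc zero} {zero}     {zero}     _   _   = refl
fin2-other {zero}     {zero}                a≢x _   = ⊥-elim (a≢x refl)
fin2-other {suc zero} {suc zero}            a≢x _   = ⊥-elim (a≢x refl)
fin2-other {zero}     {suc zero} {zero}     _   b≢x = ⊥-elim (b≢x refl)
fin2-other {suc zero} {zero}     {suc zero} _   b≢x = ⊥-elim (b≢x refl)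

upper-bounds : ∀ {n} (G : Graph n) → Connected G → ∀ {l fx f} →
               IsLocatic G l → IsFxt G fx → IsFix G f →
               (nz : NonZero f) → l ≤ fx × fx ≤ _/_ n f {{nz}}
upper-bounds G connected (locatic , _) (fixatic , fx-maximal) fix nz =
  fx-maximal _ (locatic⇒fixatic G connected locatic) , fixatic-bound G fixatic fix nz

-- On two vertices every singleton { w } is a locating set: a vertex
-- equidistant from w with w itself is w, and two vertices both different
-- from w are equal.
singleton-locating : (G : Graph 2) → ∀ w → IsLocatingSet G (λ v → v ≡ w)
singleton-locating G w u v same-code with same-code w refl | u ≟ w | v ≟ w
... | k , du , dv | yes u≡w | _       = trans u≡w (≡-sym (equidistant-from-self G du dv u≡w))
... | k , du , dv | no _    | yes v≡w = trans (equidistant-from-self G dv du v≡w) (≡-sym v≡w)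
... | _           | no u≢w  | no v≢w  = fin2-other u≢w v≢w

K₂ : Graph 2
K₂ = record { adj = edge ; sym = edge-sym ; irrefl = edge-irrefl }
  where
  edge : Fin 2 → Fin 2 → Bool
  edge zero       zero       = false
  edge zero       (suc zero) = true
  edge (suc zero) zero       = true
  edge (suc zero) (suc zero) = false

  edge-sym : ∀ u v → edge u v ≡ edge v u
  edge-sym zero       zero       = refl
  edge-sym zero       (suc zero) = refl
  edge-sym (suc zero) zero       = refl
  edge-sym (suc zero) (suc zero) = refl

  edge-irrefl : ∀ v → edge v v ≡ false
  edge-irrefl zero       = refl
  edge-irrefl (suc zero) = refl

K₂-connected : Connected K₂
K₂-connected zero       zero       = 0 , here
K₂-connected zero       (suc zero) = 1 , step refl here
K₂-connected (suc zero) zero       = 1 , step refl here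
K₂-connected (suc zero) (suc zero) = 0 , here

K₂-symmetric : Symmetric K₂
K₂-symmetric = transpose zero (suc zero) , swap-aut , λ identity → swap-moves (identity zero)
  where
  swap-aut : IsAut K₂ (transpose zero (suc zero))
  swap-aut zero       zero       = refl
  swap-aut zero       (suc zero) = refl
  swap-aut (suc zero) zero       = refl
  swap-aut (suc zero) (suc zero) = refl

  swap-moves : ¬ (transpose {2} zero (suc zero) ⟨$⟩ʳ zero ≡ zero)
  swap-moves ()

K₂-locatic-partition : LocaticPartition K₂ 2
K₂-locatic-partition = (λ v → v) , (λ i → i , λ v≡i → v≡i) , singleton-locating K₂

-- fix(K₂) = 1: the singleton { 0 } is fixing since it is locating, and no
-- fixing set of the symmetric graph K₂ is empty.
K₂-fix : IsFix K₂ 1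
K₂-fix = (⁅ zero ⁆ , ⁅0⁆-fixing , refl) , symmetric⇒fixing-nonempty K₂ K₂-symmetric
  where
  ⁅0⁆-fixing : IsFixingSet K₂ (_∈ ⁅ zero ⁆)
  ⁅0⁆-fixing σ aut σ-fixes =
    locating⇒fixing K₂ K₂-connected (λ v → v ≡ zero) (singleton-locating K₂ zero) σ aut
      λ v v≡0 → σ-fixes v (subst (_∈ ⁅ zero ⁆) (≡-sym v≡0) (x∈⁅x⁆ zero))

K₂-Fxt : IsFxt K₂ 2
K₂-Fxt = locatic⇒fixatic K₂ K₂-connected K₂-locatic-partition ,
         λ m partition → fixatic-bound K₂ partition K₂-fix _

K₂-locatic : IsLocatic K₂ 2
K₂-locatic = K₂-locatic-partition ,
             λ m partition → fixatic-bound K₂ (locatic⇒fixatic K₂ K₂-connected partition) K₂-fix _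

mainTheorem13 :
    (∀ (n : ℕ) (G : Graph n) → 2 ≤ n → Connected G → Symmetric G →
      ∀ (l fx f : ℕ) → IsLocatic G l → IsFxt G fx → IsFix G f →
      (nz : NonZero f) → l ≤ fx × fx ≤ _/_ n f {{nz}})
    × (Σ ℕ λ n → Σ (Graph n) λ G → 2 ≤ n × Connected G × Symmetric G ×
        Σ ℕ λ l → Σ ℕ λ fx → IsLocatic G l × IsFxt G fx × l ≡ fx)
    × (Σ ℕ λ n → Σ (Graph n) λ G → 2 ≤ n × Connected G × Symmetric G ×
        Σ ℕ λ fx → Σ ℕ λ f → Σ (NonZero f) λ nz →
          IsFxt G fx × IsFix G f × fx ≡ _/_ n f {{nz}})
mainTheorem13 =
  (λ n G _ connected _ l fx f → upper-bounds G connected) ,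
  (2 , K₂ , s≤s (s≤s z≤n) , K₂-connected , K₂-symmetric , 2 , 2 , K₂-locatic , K₂-Fxt , refl) ,
  (2 , K₂ , s≤s (s≤s z≤n) , K₂-connected , K₂-symmetric , 2 , 1 , _ , K₂-Fxt , K₂-fix , refl)
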